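{- Let $p\ge2$ and $m\ge0$ be integers. Then \begin{align*} &S(\bar1,p+2m+1;p)+S(\bar1,p;p+2m+1)+S(p,p+2m+1;\bar1)\\ &=S(p;\overline{p+2m+2})+S(\bar1;2p+2m+1)+S(p+2m+1;\overline{p+1})+\ln2\,\zeta(p+2m+1)\zeta(p)-\bar\zeta(2p+2m+2). \end{align*}
   Context: For positive integers $k,n$: $\zeta_n(k)=\sum_{j=1}^n j^{ -k}$, $L_n(k)=\sum_{j=1}^n(-1)^{j-1}j^{ -k}$. $\zeta(s)=\sum_{n\ge1}n^{ -s}$, $\bar\zeta(s)=\sum_{n\ge1}(-1)^{n-1}n^{ -s}$. Euler sums: for nonzero integers $p_1,\dots,p_k$ let $X_n(p_i)=\zeta_n(p_i)$ if $p_i>0$ and $X_n(p_i)=L_n(-p_i)$ if $p_i<0$, where a negative argument $-a$ is written $\bar a$; for a positive integer $q$, $S(p_1,\dots,p_k;q)=\sum_{n\ge1}X_n(p_1)\cdots X_n(p_k)n^{ -q}$ and $S(p_1,\dots,p_k;\bar q)=\sum_{n\ge1}X_n(p_1)\cdots X_n(p_k)(-1)^{n-1}n^{ -q}$. -}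

module Defs where

open import Data.Nat as ℕ using (ℕ; zero; suc; _^_; _≤_)
open import Data.Nat.Properties using (m^n≢0)
open import Data.Integer using (+_)
open import Data.Rational using (ℚ; 0ℚ; 1ℚ; _+_; _-_; _*_; -_; ∣_∣; _<_; _/_)
open import Data.Product using (∃-syntax)

-- 1 / j^k as a rational, for j ≥ 1 (argument j = suc i)
invPow : (i k : ℕ) → ℚ
invPow i k = _/_ (+ 1) (suc i ^ k) {{m^n≢0 (suc i) k}}

-- (-1)^(j-1) for j = suc i
sgn : ℕ → ℚ
sgn zero = 1ℚ
sgn (suc i) = - sgn i

ζₙ : ℕ → ℕ → ℚ
ζₙ k zero = 0ℚ
ζₙ k (suc n) = ζₙ k n + invPow n k

Lₙ : ℕ → ℕ → ℚ
Lₙ k zero = 0ℚ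
Lₙ k (suc n) = Lₙ k n + sgn n * invPow n k

-- An Euler-sum argument: pos a is a, bar a is \bar a
data Arg : Set where
  pos : ℕ → Arg
  bar : ℕ → Arg

X : Arg → ℕ → ℚ
X (pos a) n = ζₙ a n
X (bar a) n = Lₙ a n

-- weight of the n-th term (n = suc i): n^{-q} or (-1)^{n-1} n^{-q}
W : Arg → ℕ → ℚ
W (pos q) i = invPow i q
W (bar q) i = sgn i * invPow i q

-- N-th partial sums of S(p;q) and S(p1,p2;q)
S₁ : Arg → Arg → ℕ → ℚ
S₁ a q zero = 0ℚ
S₁ a q (suc i) = S₁ a q i + X a (suc i) * W q i

S₂ : Arg → Arg → Arg → ℕ → ℚ
S₂ a b q zero = 0ℚ
S₂ a b q (suc i) = S₂ a b q i + X a (suc i) * X b (suc i) * W q i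

-- partial sums of ζ(s), ζ̄(s), and ln 2 = ζ̄(1)
ζ-part : ℕ → ℕ → ℚ
ζ-part s N = ζₙ s N

ζ̄-part : ℕ → ℕ → ℚ
ζ̄-part s N = Lₙ s N

ln2-part : ℕ → ℚ
ln2-part N = Lₙ 1 N

TendsToZero : (ℕ → ℚ) → Set
TendsToZero a = ∀ (ε : ℚ) → 0ℚ < ε → ∃[ N ] (∀ n → N ≤ n → ∣ a n ∣ < ε)

LHS : ℕ → ℕ → ℕ → ℚ
LHS p m N =
  S₂ (bar 1) (pos (p ℕ.+ 2 ℕ.* m ℕ.+ 1)) (pos p) N
  + S₂ (bar 1) (pos p) (pos (p ℕ.+ 2 ℕ.* m ℕ.+ 1)) N
  + S₂ (pos p) (pos (p ℕ.+ 2 ℕ.* m ℕ.+ 1)) (bar 1) N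

RHS : ℕ → ℕ → ℕ → ℚ
RHS p m N =
  S₁ (pos p) (bar (p ℕ.+ 2 ℕ.* m ℕ.+ 2)) N
  + S₁ (bar 1) (pos (2 ℕ.* p ℕ.+ 2 ℕ.* m ℕ.+ 1)) N
  + S₁ (pos (p ℕ.+ 2 ℕ.* m ℕ.+ 1)) (bar (p ℕ.+ 1)) N
  + ln2-part N * ζ-part (p ℕ.+ 2 ℕ.* m ℕ.+ 1) N * ζ-part p N
  - ζ̄-part (2 ℕ.* p ℕ.+ 2 ℕ.* m ℕ.+ 2) N

-- Expand Lₙ(1) ζₙ(a) ζₙ(b) as a sum over triples (i, j, k) ∈ [1, N]³ and sort the triples by
-- their largest index n.  The three sums S₂ collect the triples in which a given index equals n,
-- the three sums S₁ the triples in which a given pair of indices equals n, and Lₙ(a + b + 1) the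
-- diagonal, so by inclusion–exclusion
--   Lₙ(1) ζₙ(a) ζₙ(b) = ΣS₂ − ΣS₁ + Lₙ(a + b + 1)
-- holds exactly for every N and all a, b.  With a = p + 2m + 1 and b = p this is the corollary.
module Submission where

open import Defs
open import Data.Nat using (ℕ; _≤_)
open import Data.Rational using (_-_)

import Data.Nat as Nat
open Nat using (zero; suc; NonZero)
open import Data.Nat.Properties using (m^n≢0; m*n≢0; ^-distribˡ-+-*; +-suc; +-comm)
import Data.Nat.Tactic.RingSolver as ℕ-Solver
open import Data.Integer using (+_)
open import Data.Rational using (ℚ; 0ℚ; _+_; _*_; _/_; ∣_∣; _<_; toℚᵘ)
open import Data.Rational.Properties
  using (+-*-commutativeRing; *-assoc; +-inverseʳ; _≟_; /-cong; toℚᵘ-injective; toℚᵘ-fromℚᵘ; toℚᵘ-homo-*)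
import Data.Rational.Unnormalised as ℚᵘ
import Data.Rational.Unnormalised.Properties as ℚᵘ
open import Relation.Nullary.Decidable using (dec⇒maybe)
open import Data.Product using (_,_)
open import Data.List using (_∷_; [])
open import Relation.Binary.PropositionalEquality using (_≡_; refl; sym; trans; cong; cong₂; subst; module ≡-Reasoning)
open import Tactic.RingSolver using (solve-∀; solve)
open import Tactic.RingSolver.Core.AlmostCommutativeRing using (AlmostCommutativeRing; fromCommutativeRing)

ℚ-ring : AlmostCommutativeRing _ _
ℚ-ring = fromCommutativeRing +-*-commutativeRing (λ x → dec⇒maybe (0ℚ ≟ x))

1/[m*n]≡1/m*1/n : ∀ m n .{{_ : NonZero m}} .{{_ : NonZero n}} →
  ((+ 1) / (m Nat.* n)) {{m*n≢0 m n}} ≡ (+ 1 / m) * (+ 1 / n)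
1/[m*n]≡1/m*1/n (suc a) (suc b) = toℚᵘ-injective (begin
  toℚᵘ (+ 1 / (suc a Nat.* suc b))           ≈⟨ toℚᵘ-fromℚᵘ (1/a ℚᵘ.* 1/b) ⟩
  1/a ℚᵘ.* 1/b                               ≈⟨ ℚᵘ.*-cong (toℚᵘ-fromℚᵘ 1/a) (toℚᵘ-fromℚᵘ 1/b) ⟨
  toℚᵘ (+ 1 / suc a) ℚᵘ.* toℚᵘ (+ 1 / suc b)  ≈⟨ toℚᵘ-homo-* (+ 1 / suc a) (+ 1 / suc b) ⟨
  toℚᵘ ((+ 1 / suc a) * (+ 1 / suc b))        ∎)
  where
  open ℚᵘ.≃-Reasoning
  1/a 1/b : ℚᵘ.ℚᵘ
  1/a = ℚᵘ.mkℚᵘ (+ 1) a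
  1/b = ℚᵘ.mkℚᵘ (+ 1) b

W-pos-+ : ∀ j k i → W (pos (j Nat.+ k)) i ≡ W (pos j) i * W (pos k) i
W-pos-+ j k i = trans
  (/-cong {+ 1} {p₂ = + 1} {{m^n≢0 (suc i) (j Nat.+ k)}} {{m*n≢0 _ _ {{iʲ≢0}} {{iᵏ≢0}}}}
    refl (^-distribˡ-+-* (suc i) j k))
  (1/[m*n]≡1/m*1/n (suc i Nat.^ j) (suc i Nat.^ k) {{iʲ≢0}} {{iᵏ≢0}})
  where
  iʲ≢0 = m^n≢0 (suc i) j
  iᵏ≢0 = m^n≢0 (suc i) k

W-bar-+ : ∀ j k i → W (bar (j Nat.+ k)) i ≡ W (bar j) i * W (pos k) i
W-bar-+ j k i = begin
  sgn i * invPow i (j Nat.+ k)         ≡⟨ cong (sgn i *_) (W-pos-+ j k i) ⟩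
  sgn i * (invPow i j * invPow i k)    ≡⟨ *-assoc (sgn i) (invPow i j) (invPow i k) ⟨
  sgn i * invPow i j * invPow i k      ∎
  where open ≡-Reasoning

inclusion-exclusion³ : ∀ A B C α β γ →
  (A + α) * (B + β) * (C + γ)
    + ((C + γ) * (α * β) + (A + α) * (β * γ) + (B + β) * (α * γ))
  ≡ A * B * C
    + ((A + α) * (B + β) * γ + (A + α) * (C + γ) * β + (C + γ) * (B + β) * α)
    + α * (β * γ)
inclusion-exclusion³ = solve-∀ ℚ-ring

stuffle-step : ∀ A B C α β γ R₁ R₂ R₃ T₁ T₂ T₃ L →
  A * B * C + (R₁ + R₂ + R₃) ≡ T₁ + T₂ + T₃ + L →
  (A + α) * (B + β) * (C + γ)
    + ((R₁ + (C + γ) * (α * β)) + (R₂ + (A + α) * (β * γ)) + (R₃ + (B + β) * (α * γ)))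
  ≡ (T₁ + (A + α) * (B + β) * γ) + (T₂ + (A + α) * (C + γ) * β) + (T₃ + (C + γ) * (B + β) * α)
    + (L + α * (β * γ))
stuffle-step A B C α β γ R₁ R₂ R₃ T₁ T₂ T₃ L ih = begin
    (A + α) * (B + β) * (C + γ)
      + ((R₁ + (C + γ) * (α * β)) + (R₂ + (A + α) * (β * γ)) + (R₃ + (B + β) * (α * γ)))
  ≡⟨ solve (A ∷ B ∷ C ∷ α ∷ β ∷ γ ∷ R₁ ∷ R₂ ∷ R₃ ∷ []) ℚ-ring ⟩
    ((A + α) * (B + β) * (C + γ)
      + ((C + γ) * (α * β) + (A + α) * (β * γ) + (B + β) * (α * γ)))
      + (R₁ + R₂ + R₃)
  ≡⟨ cong (_+ _) (inclusion-exclusion³ A B C α β γ) ⟩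
    (A * B * C
      + ((A + α) * (B + β) * γ + (A + α) * (C + γ) * β + (C + γ) * (B + β) * α)
      + α * (β * γ))
      + (R₁ + R₂ + R₃)
  ≡⟨ solve (A ∷ B ∷ C ∷ α ∷ β ∷ γ ∷ R₁ ∷ R₂ ∷ R₃ ∷ []) ℚ-ring ⟩
    (A * B * C + (R₁ + R₂ + R₃))
      + (((A + α) * (B + β) * γ + (A + α) * (C + γ) * β + (C + γ) * (B + β) * α) + α * (β * γ))
  ≡⟨ cong (_+ _) ih ⟩
    (T₁ + T₂ + T₃ + L)
      + (((A + α) * (B + β) * γ + (A + α) * (C + γ) * β + (C + γ) * (B + β) * α) + α * (β * γ))
  ≡⟨ solve (A ∷ B ∷ C ∷ α ∷ β ∷ γ ∷ T₁ ∷ T₂ ∷ T₃ ∷ L ∷ []) ℚ-ring ⟩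
    (T₁ + (A + α) * (B + β) * γ) + (T₂ + (A + α) * (C + γ) * β) + (T₃ + (C + γ) * (B + β) * α)
      + (L + α * (β * γ))
  ∎
  where open ≡-Reasoning

S₂-triple : ℕ → ℕ → ℕ → ℚ
S₂-triple a b N =
  S₂ (bar 1) (pos a) (pos b) N + S₂ (bar 1) (pos b) (pos a) N + S₂ (pos b) (pos a) (bar 1) N

S₁-triple : ℕ → ℕ → ℕ → ℚ
S₁-triple a b N =
  S₁ (pos b) (bar (suc a)) N + S₁ (bar 1) (pos (a Nat.+ b)) N + S₁ (pos a) (bar (suc b)) N

Lₙ-ζₙ-ζₙ-stuffle : ∀ a b N →
  Lₙ 1 N * ζₙ a N * ζₙ b N + S₁-triple a b N ≡ S₂-triple a b N + Lₙ (suc (a Nat.+ b)) N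
Lₙ-ζₙ-ζₙ-stuffle a b zero    = refl
Lₙ-ζₙ-ζₙ-stuffle a b (suc N) = begin
    (A + α) * (B + β) * (C + γ) + S₁-triple a b (suc N)
  ≡⟨ cong (λ w → (A + α) * (B + β) * (C + γ) + w) S₁-triple-suc ⟩
    (A + α) * (B + β) * (C + γ)
      + ((R₁ + (C + γ) * (α * β)) + (R₂ + (A + α) * (β * γ)) + (R₃ + (B + β) * (α * γ)))
  ≡⟨ stuffle-step A B C α β γ R₁ R₂ R₃ T₁ T₂ T₃ L (Lₙ-ζₙ-ζₙ-stuffle a b N) ⟩
    S₂-triple a b (suc N) + (L + α * (β * γ))
  ≡⟨ cong (λ w → S₂-triple a b (suc N) + (L + w)) Lₙ-weight ⟨
    S₂-triple a b (suc N) + Lₙ (suc (a Nat.+ b)) (suc N)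
  ∎
  where
  open ≡-Reasoning
  A B C α β γ R₁ R₂ R₃ T₁ T₂ T₃ L : ℚ
  A = Lₙ 1 N
  B = ζₙ a N
  C = ζₙ b N
  α = W (bar 1) N
  β = W (pos a) N
  γ = W (pos b) N
  R₁ = S₁ (pos b) (bar (suc a)) N
  R₂ = S₁ (bar 1) (pos (a Nat.+ b)) N
  R₃ = S₁ (pos a) (bar (suc b)) N
  T₁ = S₂ (bar 1) (pos a) (pos b) N
  T₂ = S₂ (bar 1) (pos b) (pos a) N
  T₃ = S₂ (pos b) (pos a) (bar 1) N
  L  = Lₙ (suc (a Nat.+ b)) N

  S₁-triple-suc : S₁-triple a b (suc N)
    ≡ (R₁ + (C + γ) * (α * β)) + (R₂ + (A + α) * (β * γ)) + (R₃ + (B + β) * (α * γ))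
  S₁-triple-suc = cong₂ _+_ (cong₂ _+_
    (cong (λ w → R₁ + (C + γ) * w) (W-bar-+ 1 a N))
    (cong (λ w → R₂ + (A + α) * w) (W-pos-+ a b N)))
    (cong (λ w → R₃ + (B + β) * w) (W-bar-+ 1 b N))

  Lₙ-weight : W (bar (suc (a Nat.+ b))) N ≡ α * (β * γ)
  Lₙ-weight = begin
    W (bar (1 Nat.+ (a Nat.+ b))) N        ≡⟨ W-bar-+ 1 (a Nat.+ b) N ⟩
    α * W (pos (a Nat.+ b)) N              ≡⟨ cong (α *_) (W-pos-+ a b N) ⟩
    α * (β * γ)                            ∎

difference-vanishes : ∀ T R P L → P + R ≡ T + L → T - (R + P - L) ≡ 0ℚ
difference-vanishes T R P L P+R≡T+L = begin
  T - (R + P - L)        ≡⟨ solve (T ∷ R ∷ P ∷ L ∷ []) ℚ-ring ⟩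
  (T + L) - (P + R)      ≡⟨ cong (_- (P + R)) P+R≡T+L ⟨
  (P + R) - (P + R)      ≡⟨ +-inverseʳ (P + R) ⟩
  0ℚ                     ∎
  where open ≡-Reasoning

RHS-reindexed : ∀ p m N → let a = p Nat.+ 2 Nat.* m Nat.+ 1 in
  RHS p m N ≡ S₁-triple a p N + Lₙ 1 N * ζₙ a N * ζₙ p N - Lₙ (suc (a Nat.+ p)) N
RHS-reindexed p m N = reindex (+-suc (p Nat.+ 2 Nat.* m) 1) a+p (+-comm p 1) 1+a+p
  where
  a = p Nat.+ 2 Nat.* m Nat.+ 1
  a+p : 2 Nat.* p Nat.+ 2 Nat.* m Nat.+ 1 ≡ p Nat.+ 2 Nat.* m Nat.+ 1 Nat.+ p
  a+p = ℕ-Solver.solve (p ∷ m ∷ [])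
  1+a+p : 2 Nat.* p Nat.+ 2 Nat.* m Nat.+ 2 ≡ suc (p Nat.+ 2 Nat.* m Nat.+ 1 Nat.+ p)
  1+a+p = ℕ-Solver.solve (p ∷ m ∷ [])
  reindex : ∀ {c d e f} → c ≡ suc a → d ≡ a Nat.+ p → e ≡ suc p → f ≡ suc (a Nat.+ p) →
    S₁ (pos p) (bar c) N + S₁ (bar 1) (pos d) N + S₁ (pos a) (bar e) N
      + Lₙ 1 N * ζₙ a N * ζₙ p N - Lₙ f N
    ≡ S₁-triple a p N + Lₙ 1 N * ζₙ a N * ζₙ p N - Lₙ (suc (a Nat.+ p)) N
  reindex refl refl refl refl = refl

identically-zero⇒tendsToZero : ∀ {x} → (∀ n → x n ≡ 0ℚ) → TendsToZero x
identically-zero⇒tendsToZero {x} x≡0 ε 0<ε = 0 , λ n _ → subst (λ y → ∣ y ∣ < ε) (sym (x≡0 n)) 0<ε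

LHS-RHS≡0 : ∀ p m N → LHS p m N - RHS p m N ≡ 0ℚ
LHS-RHS≡0 p m N = begin
    LHS p m N - RHS p m N
  ≡⟨ cong (LHS p m N -_) (RHS-reindexed p m N) ⟩
    T - (R + P - L)
  ≡⟨ difference-vanishes T R P L (Lₙ-ζₙ-ζₙ-stuffle a p N) ⟩
    0ℚ
  ∎
  where
  open ≡-Reasoning
  a = p Nat.+ 2 Nat.* m Nat.+ 1
  T R P L : ℚ
  T = S₂-triple a p N
  R = S₁-triple a p N
  P = Lₙ 1 N * ζₙ a N * ζₙ p N
  L = Lₙ (suc (a Nat.+ p)) N

-- 2 ≤ p only matters for the convergence of the series; their partial sums already agree.
corollary2p9 : (p m : ℕ) → 2 ≤ p → TendsToZero (λ N → LHS p m N - RHS p m N)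
corollary2p9 p m _ = identically-zero⇒tendsToZero (LHS-RHS≡0 p m)
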